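{- For every $I$-pointed partially observable $FT(\_)^A$-coalgebra $(i,\langle\delta,\mathrm{obs}\rangle)$ with $i\colon I\to S$, $\delta\colon S\to(FTS)^A$, $\mathrm{obs}\colon S\to O$, one has $V(i,\langle\delta,\mathrm{obs}\rangle)\le V(i,\langle\delta,\mathrm{id}_S\rangle)$ in $\mathcal{C}(I,\Omega)$. If $\mathrm{obs}$ is a split monomorphism, then $V(i,\langle\delta,\mathrm{obs}\rangle)=V(i,\langle\delta,\mathrm{id}_S\rangle)$.
   Context: $\mathcal{C}$ is a cartesian closed category with finite products, pullbacks and countable coproducts; $f^\dagger$ is adjoint transpose. $T=(T,\eta,\mu)$ is a strong monad and $F$ a strong endofunctor; $\mathrm{st}$ denotes the strengths of $T$, $F$, $FT$ (used on either side via symmetry). $A$, $I$ are fixed objects. $\Omega$ is an ordered object (each $\mathcal{C}(X,\Omega)$ a complete lattice with order $\le$, precomposition preserving arbitrary joins, bottom $\bot$); $\tau\colon FT\Omega\to\Omega$ is a monotone algebra ($g\mapsto\tau\circ FTg$ monotone). For an $FT$-coalgebra $e\colon X\to FTX$, $\Phi_e(g):=\tau\circ FTg\circ e$. Sequences: $X^*=\coprod_{n\ge0}X^n$, $X^+=\coprod_{n\ge1}X^n$; $\mathsf{cons}_P\colon P\times P^*\cong P^+$; $A^{P^*}\cong A\times A^{P^+}$ via $P^*\cong1+P^+$; $\mathrm{ev}\colon P\times A^{P^+}\to A^{P^*}$ is the transpose of $(o,h,w)\mapsto h(\mathsf{cons}_P(o,w))$. For $c=\langle\delta,p\rangle\colon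 S\to(FTS)^A\times P$ (here $P$ is $O$ or $S$), $\mathsf{Sch}(c)\colon S\times A^{P^*}\to FT(S\times A^{P^*})$ is $S\times A^{P^*}\cong S\times A\times A^{P^+}\xrightarrow{\delta^\dagger\times\mathrm{id}}FTS\times A^{P^+}\xrightarrow{\mathrm{st}}FT(S\times A^{P^+})\xrightarrow{FT\langle\pi_1,\mathrm{ev}\circ(p\times\mathrm{id})\rangle}FT(S\times A^{P^*})$ and $V(i,c):=\bigvee_{u\colon P^+\to A,\,n\in\mathbb{N}}\Phi^n_{\mathsf{Sch}(c)}(\bot)\circ\langle\mathrm{id}_S,(u\circ\mathsf{cons}_P)^\dagger\circ p\rangle\circ i\colon I\to\Omega$. -}

module Defs where

open import Level using (Level; _⊔_) renaming (suc to lsuc)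
open import Data.Nat using (ℕ) renaming (zero to nzero; suc to nsuc)
open import Data.Product using (Σ; _,_) renaming (_×_ to _∧_)
open import Data.Empty.Polymorphic using (⊥; ⊥-elim)
open import Relation.Binary.PropositionalEquality using (_≡_)

record CCC (o ℓ : Level) : Set (lsuc (o ⊔ ℓ)) where
  infixr 9 _∘_
  infixr 6 _⇨_
  infixr 7 _⊗_
  field
    Obj : Set o
    Hom : Obj → Obj → Set ℓ
    id  : ∀ {X} → Hom X X
    _∘_ : ∀ {X Y Z} → Hom Y Z → Hom X Y → Hom X Z
    identityˡ : ∀ {X Y} {f : Hom X Y} → id ∘ f ≡ f
    identityʳ : ∀ {X Y} {f : Hom X Y} → f ∘ id ≡ f
    assoc : ∀ {W X Y Z} {f : Hom W X} {g : Hom X Y} {h : Hom Y Z} →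
            (h ∘ g) ∘ f ≡ h ∘ (g ∘ f)

    𝟙 : Obj
    ! : ∀ {X} → Hom X 𝟙
    !-unique : ∀ {X} (f : Hom X 𝟙) → f ≡ !

    _⊗_ : Obj → Obj → Obj
    π₁ : ∀ {X Y} → Hom (X ⊗ Y) X
    π₂ : ∀ {X Y} → Hom (X ⊗ Y) Y
    ⟨_,_⟩ : ∀ {W X Y} → Hom W X → Hom W Y → Hom W (X ⊗ Y)
    π₁-β : ∀ {W X Y} {f : Hom W X} {g : Hom W Y} → π₁ ∘ ⟨ f , g ⟩ ≡ f
    π₂-β : ∀ {W X Y} {f : Hom W X} {g : Hom W Y} → π₂ ∘ ⟨ f , g ⟩ ≡ g
    ⟨⟩-unique : ∀ {W X Y} {f : Hom W X} {g : Hom W Y} {h : Hom W (X ⊗ Y)} →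
                π₁ ∘ h ≡ f → π₂ ∘ h ≡ g → h ≡ ⟨ f , g ⟩

    _⇨_ : Obj → Obj → Obj
    eval : ∀ {Y Z} → Hom ((Y ⇨ Z) ⊗ Y) Z
    curry : ∀ {X Y Z} → Hom (X ⊗ Y) Z → Hom X (Y ⇨ Z)
    eval-β : ∀ {X Y Z} {f : Hom (X ⊗ Y) Z} →
             eval ∘ ⟨ curry f ∘ π₁ , id ∘ π₂ ⟩ ≡ f
    curry-unique : ∀ {X Y Z} {f : Hom (X ⊗ Y) Z} {g : Hom X (Y ⇨ Z)} →
                   eval ∘ ⟨ g ∘ π₁ , id ∘ π₂ ⟩ ≡ f → g ≡ curry f

    pb : ∀ {X Y Z} → Hom X Z → Hom Y Z → Obj
    pb₁ : ∀ {X Y Z} {f : Hom X Z} {g : Hom Y Z} → Hom (pb f g) X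
    pb₂ : ∀ {X Y Z} {f : Hom X Z} {g : Hom Y Z} → Hom (pb f g) Y
    pb-commute : ∀ {X Y Z} {f : Hom X Z} {g : Hom Y Z} →
                 f ∘ pb₁ {f = f} {g} ≡ g ∘ pb₂ {f = f} {g}
    pb-univ : ∀ {W X Y Z} {f : Hom X Z} {g : Hom Y Z}
              (h : Hom W X) (k : Hom W Y) → f ∘ h ≡ g ∘ k → Hom W (pb f g)
    pb-univ₁ : ∀ {W X Y Z} {f : Hom X Z} {g : Hom Y Z}
               {h : Hom W X} {k : Hom W Y} (eq : f ∘ h ≡ g ∘ k) →
               pb₁ ∘ pb-univ h k eq ≡ h
    pb-univ₂ : ∀ {W X Y Z} {f : Hom X Z} {g : Hom Y Z}
               {h : Hom W X} {k : Hom W Y} (eq : f ∘ h ≡ g ∘ k) →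
               pb₂ ∘ pb-univ h k eq ≡ k
    pb-unique : ∀ {W X Y Z} {f : Hom X Z} {g : Hom Y Z}
                {h : Hom W X} {k : Hom W Y} (eq : f ∘ h ≡ g ∘ k)
                (u : Hom W (pb f g)) → pb₁ ∘ u ≡ h → pb₂ ∘ u ≡ k →
                u ≡ pb-univ h k eq

    ∐ : (ℕ → Obj) → Obj
    inj : ∀ {X : ℕ → Obj} (n : ℕ) → Hom (X n) (∐ X)
    copair : ∀ {X : ℕ → Obj} {Z} → ((n : ℕ) → Hom (X n) Z) → Hom (∐ X) Z
    copair-β : ∀ {X : ℕ → Obj} {Z} {f : (n : ℕ) → Hom (X n) Z} (n : ℕ) →
               copair f ∘ inj n ≡ f n
    copair-unique : ∀ {X : ℕ → Obj} {Z} {f : (n : ℕ) → Hom (X n) Z}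
                    {h : Hom (∐ X) Z} → ((n : ℕ) → h ∘ inj n ≡ f n) →
                    h ≡ copair f

module CCCKit {o ℓ} (C : CCC o ℓ) where
  open CCC C public

  infixr 7 _⊗₁_
  _⊗₁_ : ∀ {X X′ Y Y′} → Hom X X′ → Hom Y Y′ → Hom (X ⊗ Y) (X′ ⊗ Y′)
  f ⊗₁ g = ⟨ f ∘ π₁ , g ∘ π₂ ⟩

  swap : ∀ {X Y} → Hom (X ⊗ Y) (Y ⊗ X)
  swap = ⟨ π₂ , π₁ ⟩

  α : ∀ {X Y Z} → Hom ((X ⊗ Y) ⊗ Z) (X ⊗ (Y ⊗ Z))
  α = ⟨ π₁ ∘ π₁ , ⟨ π₂ ∘ π₁ , π₂ ⟩ ⟩

  uncurry : ∀ {X Y Z} → Hom X (Y ⇨ Z) → Hom (X ⊗ Y) Z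
  uncurry f = eval ∘ (f ⊗₁ id)

  pow : Obj → ℕ → Obj
  pow X nzero = 𝟙
  pow X (nsuc n) = X ⊗ pow X n

  _* : Obj → Obj
  X * = ∐ (pow X)

  _⁺ : Obj → Obj
  X ⁺ = ∐ (λ n → pow X (nsuc n))

  -- cons_P : P × P* → P⁺  (the canonical iso)
  cons : ∀ {P} → Hom (P ⊗ P *) (P ⁺)
  cons {P} = uncurry (copair (λ n → curry (inj {X = λ m → pow P (nsuc m)} n ∘ swap))) ∘ swap

  -- inclusion P⁺ → P*  and empty word 1 → P*  (P* ≅ 1 + P⁺)
  incl : ∀ {P} → Hom (P ⁺) (P *)
  incl {P} = copair (λ n → inj {X = pow P} (nsuc n))

  nil : ∀ {P} → Hom 𝟙 (P *)
  nil {P} = inj {X = pow P} nzero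

  -- the two components of  A^{P*} ≅ A × A^{P⁺}
  head : ∀ {P A} → Hom (P * ⇨ A) A
  head = eval ∘ ⟨ id , nil ∘ ! ⟩

  tail : ∀ {P A} → Hom (P * ⇨ A) (P ⁺ ⇨ A)
  tail = curry (eval ∘ (id ⊗₁ incl))

  -- ev : P × A^{P⁺} → A^{P*},  transpose of (o,h,w) ↦ h(cons(o,w))
  evP : ∀ {P A} → Hom (P ⊗ (P ⁺ ⇨ A)) (P * ⇨ A)
  evP = curry (eval ∘ ⟨ π₂ ∘ π₁ , cons ∘ ⟨ π₁ ∘ π₁ , π₂ ⟩ ⟩)

  SplitMono : ∀ {X Y} → Hom X Y → Set ℓ
  SplitMono {X} {Y} m = Σ (Hom Y X) (λ r → r ∘ m ≡ id)

module _ {o ℓ} (C : CCC o ℓ) where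
  open CCCKit C

  record StrongEndofunctor : Set (o ⊔ ℓ) where
    field
      F₀ : Obj → Obj
      F₁ : ∀ {X Y} → Hom X Y → Hom (F₀ X) (F₀ Y)
      F-id : ∀ {X} → F₁ (id {X}) ≡ id
      F-∘ : ∀ {X Y Z} {f : Hom X Y} {g : Hom Y Z} → F₁ (g ∘ f) ≡ F₁ g ∘ F₁ f
      st : ∀ {X Y} → Hom (X ⊗ F₀ Y) (F₀ (X ⊗ Y))
      st-natural : ∀ {X X′ Y Y′} {f : Hom X X′} {g : Hom Y Y′} →
                   st ∘ (f ⊗₁ F₁ g) ≡ F₁ (f ⊗₁ g) ∘ st
      st-unit : ∀ {Y} → F₁ π₂ ∘ st {𝟙} {Y} ≡ π₂
      st-assoc : ∀ {X Y Z} →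
                 F₁ α ∘ st {X ⊗ Y} {Z} ≡ st {X} {Y ⊗ Z} ∘ (id ⊗₁ st {Y} {Z}) ∘ α

  record StrongMonad : Set (o ⊔ ℓ) where
    field
      functor : StrongEndofunctor
    open StrongEndofunctor functor public
    field
      η : ∀ {X} → Hom X (F₀ X)
      μ : ∀ {X} → Hom (F₀ (F₀ X)) (F₀ X)
      η-natural : ∀ {X Y} {f : Hom X Y} → F₁ f ∘ η ≡ η ∘ f
      μ-natural : ∀ {X Y} {f : Hom X Y} → F₁ f ∘ μ ≡ μ ∘ F₁ (F₁ f)
      μ-assoc : ∀ {X} → μ {X} ∘ F₁ μ ≡ μ ∘ μ
      μ-η : ∀ {X} → μ {X} ∘ η ≡ id
      μ-Fη : ∀ {X} → μ {X} ∘ F₁ η ≡ id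
      st-η : ∀ {X Y} → st {X} {Y} ∘ (id ⊗₁ η) ≡ η
      st-μ : ∀ {X Y} → st {X} {Y} ∘ (id ⊗₁ μ) ≡ μ ∘ F₁ st ∘ st

  record OrderedObject : Set (o ⊔ lsuc ℓ) where
    infix 4 _≤_
    field
      Ω : Obj
      _≤_ : ∀ {X} → Hom X Ω → Hom X Ω → Set ℓ
      ≤-refl : ∀ {X} {f : Hom X Ω} → f ≤ f
      ≤-trans : ∀ {X} {f g h : Hom X Ω} → f ≤ g → g ≤ h → f ≤ h
      ≤-antisym : ∀ {X} {f g : Hom X Ω} → f ≤ g → g ≤ f → f ≡ g
      ⋁ : ∀ {X} {J : Set ℓ} → (J → Hom X Ω) → Hom X Ω
      ⋁-upper : ∀ {X} {J : Set ℓ} (f : J → Hom X Ω) (j : J) → f j ≤ ⋁ f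
      ⋁-least : ∀ {X} {J : Set ℓ} (f : J → Hom X Ω) {g : Hom X Ω} →
                ((j : J) → f j ≤ g) → ⋁ f ≤ g
      ⋁-precomp : ∀ {X Y} {J : Set ℓ} (f : J → Hom Y Ω) (h : Hom X Y) →
                  ⋁ f ∘ h ≡ ⋁ (λ j → f j ∘ h)

    ⊥Ω : ∀ {X} → Hom X Ω
    ⊥Ω = ⋁ {J = ⊥} ⊥-elim

module _ {o ℓ} {C : CCC o ℓ} (T : StrongMonad C) (F : StrongEndofunctor C) where
  open CCCKit C
  private
    module T = StrongMonad T
    module F = StrongEndofunctor F

  FT : Obj → Obj
  FT X = F.F₀ (T.F₀ X)

  FT₁ : ∀ {X Y} → Hom X Y → Hom (FT X) (FT Y)
  FT₁ f = F.F₁ (T.F₁ f)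

  stFT : ∀ {X Y} → Hom (X ⊗ FT Y) (FT (X ⊗ Y))
  stFT = F.F₁ T.st ∘ F.st

  stFTʳ : ∀ {X Y} → Hom (FT X ⊗ Y) (FT (X ⊗ Y))
  stFTʳ = FT₁ swap ∘ stFT ∘ swap

  record MonotoneAlgebra (Ω′ : OrderedObject C) : Set (o ⊔ ℓ) where
    open OrderedObject Ω′
    field
      τ : Hom (FT Ω) Ω
      τ-monotone : ∀ {X} {g g′ : Hom X Ω} → g ≤ g′ → τ ∘ FT₁ g ≤ τ ∘ FT₁ g′

  module Value {Ω′ : OrderedObject C} (alg : MonotoneAlgebra Ω′) (A I : Obj) where
    open OrderedObject Ω′
    open MonotoneAlgebra alg

    Φ : ∀ {X} → Hom X (FT X) → Hom X Ω → Hom X Ω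
    Φ e g = τ ∘ FT₁ g ∘ e

    iter : ∀ {X} → ℕ → (Hom X Ω → Hom X Ω) → Hom X Ω → Hom X Ω
    iter nzero h g = g
    iter (nsuc n) h g = h (iter n h g)

    Sch : ∀ {S P} → Hom S (A ⇨ FT S) → Hom S P →
          Hom (S ⊗ (P * ⇨ A)) (FT (S ⊗ (P * ⇨ A)))
    Sch δ p = FT₁ ⟨ π₁ , evP ∘ (p ⊗₁ id) ⟩
            ∘ stFTʳ
            ∘ (uncurry δ ⊗₁ id)
            ∘ ⟨ ⟨ π₁ , head ∘ π₂ ⟩ , tail ∘ π₂ ⟩

    V : ∀ {S P} → Hom I S → Hom S (A ⇨ FT S) → Hom S P → Hom I Ω
    V {S} {P} i δ p =
      ⋁ {J = Hom (P ⁺) A ∧ ℕ}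
        (λ { (u , n) → iter n (Φ (Sch δ p)) ⊥Ω
                         ∘ ⟨ id , curry (u ∘ cons) ∘ p ⟩ ∘ i })

-- For f : P → Q, precomposition with f* : P* → Q* turns continuations in A^{Q*} into
-- continuations in A^{P*}.  Since f* fixes the empty word and commutes with cons, the map
-- id × (_ ∘ f*) : S × A^{Q*} → S × A^{P*} is a morphism of FT-coalgebras from Sch⟨δ, f ∘ p⟩
-- to Sch⟨δ, p⟩.  The iterates of Φ pull back along coalgebra morphisms, and the morphism
-- sends the initial state of a strategy u : Q⁺ → A to that of u ∘ f⁺.  So every approximant
-- of V(i, ⟨δ, f ∘ p⟩) is an approximant of V(i, ⟨δ, p⟩); if f has a retraction r then
-- u = (u ∘ r⁺) ∘ f⁺ for every u, which gives the converse.  The proposition is the case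
-- p = id, f = obs.
module Submission where

open import Defs
open import Data.Nat using (ℕ) renaming (zero to nzero; suc to nsuc)
open import Data.Product using (_×_; _,_)
open import Data.Empty.Polymorphic using (⊥-elim)
open import Relation.Binary.PropositionalEquality

module CartesianClosedProperties {o ℓ} (C : CCC o ℓ) where
  open CCCKit C
  open ≡-Reasoning

  private variable
    W X Y Z X′ Y′ Z′ : Obj

  glue : {a : Hom Y Z} {b : Hom X Y} {k₁ : Hom X′ X} {k₂ : Hom Y′ Y} {k₃ : Hom Z′ Z}
         {a′ : Hom Y′ Z′} {b′ : Hom X′ Y′} →
         a ∘ k₂ ≡ k₃ ∘ a′ → b ∘ k₁ ≡ k₂ ∘ b′ → (a ∘ b) ∘ k₁ ≡ k₃ ∘ (a′ ∘ b′)
  glue sq₁ sq₂ =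
    trans assoc (trans (cong (_ ∘_) sq₂) (trans (sym assoc) (trans (cong (_∘ _) sq₁) assoc)))

  ⟨⟩∘ : {f : Hom X Y} {g : Hom X Z} {h : Hom W X} → ⟨ f , g ⟩ ∘ h ≡ ⟨ f ∘ h , g ∘ h ⟩
  ⟨⟩∘ = ⟨⟩-unique (trans (sym assoc) (cong (_∘ _) π₁-β)) (trans (sym assoc) (cong (_∘ _) π₂-β))

  ⟨π₁,π₂⟩≡id : ⟨ π₁ , π₂ ⟩ ≡ id {X ⊗ Y}
  ⟨π₁,π₂⟩≡id = sym (⟨⟩-unique identityʳ identityʳ)

  ⊗₁∘⟨⟩ : {f : Hom X X′} {g : Hom Y Y′} {h : Hom W X} {k : Hom W Y} →
          (f ⊗₁ g) ∘ ⟨ h , k ⟩ ≡ ⟨ f ∘ h , g ∘ k ⟩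
  ⊗₁∘⟨⟩ = trans ⟨⟩∘ (cong₂ ⟨_,_⟩ (trans assoc (cong (_ ∘_) π₁-β)) (trans assoc (cong (_ ∘_) π₂-β)))

  ∘π₁∘⊗₁ : {x : Hom X Z} {f : Hom W X} {g : Hom Y Y′} → (x ∘ π₁) ∘ (f ⊗₁ g) ≡ (x ∘ f) ∘ π₁
  ∘π₁∘⊗₁ = trans assoc (trans (cong (_ ∘_) π₁-β) (sym assoc))

  ∘π₂∘⊗₁ : {x : Hom Y Z} {f : Hom X X′} {g : Hom W Y} → (x ∘ π₂) ∘ (f ⊗₁ g) ≡ (x ∘ g) ∘ π₂
  ∘π₂∘⊗₁ = trans assoc (trans (cong (_ ∘_) π₂-β) (sym assoc))

  π₁∘π₁∘⊗₁⊗₁ : {a : Hom X X′} {b : Hom Y Y′} {c : Hom Z Z′} →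
                (π₁ ∘ π₁) ∘ ((a ⊗₁ b) ⊗₁ c) ≡ a ∘ π₁ ∘ π₁
  π₁∘π₁∘⊗₁⊗₁ = trans (trans ∘π₁∘⊗₁ (cong (_∘ π₁) π₁-β)) assoc

  π₂∘π₁∘⊗₁⊗₁ : {a : Hom X X′} {b : Hom Y Y′} {c : Hom Z Z′} →
                (π₂ ∘ π₁) ∘ ((a ⊗₁ b) ⊗₁ c) ≡ b ∘ π₂ ∘ π₁
  π₂∘π₁∘⊗₁⊗₁ = trans (trans ∘π₁∘⊗₁ (cong (_∘ π₁) π₂-β)) assoc

  ⊗₁∘⊗₁ : ∀ {X″ Y″} {f : Hom X′ X″} {g : Hom Y′ Y″} {f′ : Hom X X′} {g′ : Hom Y Y′} →
          (f ⊗₁ g) ∘ (f′ ⊗₁ g′) ≡ (f ∘ f′) ⊗₁ (g ∘ g′)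
  ⊗₁∘⊗₁ = trans ⊗₁∘⟨⟩ (cong₂ ⟨_,_⟩ (sym assoc) (sym assoc))

  id⊗₁id : id {X} ⊗₁ id {Y} ≡ id
  id⊗₁id = sym (⟨⟩-unique (trans identityʳ (sym identityˡ)) (trans identityʳ (sym identityˡ)))

  ⊗₁≡⊗₁id∘id⊗₁ : {f : Hom X X′} {g : Hom Y Y′} → f ⊗₁ g ≡ (f ⊗₁ id) ∘ (id ⊗₁ g)
  ⊗₁≡⊗₁id∘id⊗₁ = sym (trans ⊗₁∘⊗₁ (cong₂ _⊗₁_ identityʳ identityˡ))

  ⊗₁≡id⊗₁∘⊗₁id : {f : Hom X X′} {g : Hom Y Y′} → f ⊗₁ g ≡ (id ⊗₁ g) ∘ (f ⊗₁ id)
  ⊗₁≡id⊗₁∘⊗₁id = sym (trans ⊗₁∘⊗₁ (cong₂ _⊗₁_ identityˡ identityʳ))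

  ⊗₁-interchange : {f : Hom X X′} {g : Hom Y Y′} → (f ⊗₁ id) ∘ (id ⊗₁ g) ≡ (id ⊗₁ g) ∘ (f ⊗₁ id)
  ⊗₁-interchange = trans (sym ⊗₁≡⊗₁id∘id⊗₁) ⊗₁≡id⊗₁∘⊗₁id

  ⊗₁id∘⊗₁id : ∀ {X″} {f : Hom X′ X″} {g : Hom X X′} → (f ⊗₁ id {Y}) ∘ (g ⊗₁ id) ≡ (f ∘ g) ⊗₁ id
  ⊗₁id∘⊗₁id = trans ⊗₁∘⊗₁ (cong (_ ⊗₁_) identityˡ)

  ⊗₁∘id⊗₁ : {f : Hom X X′} {g : Hom Y Y′} {h : Hom W Y} → (f ⊗₁ g) ∘ (id ⊗₁ h) ≡ f ⊗₁ (g ∘ h)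
  ⊗₁∘id⊗₁ = trans ⊗₁∘⊗₁ (cong (_⊗₁ _) identityʳ)

  id⊗₁∘⊗₁ : {f : Hom X X′} {g : Hom Y Y′} {h : Hom Y′ W} → (id ⊗₁ h) ∘ (f ⊗₁ g) ≡ f ⊗₁ (h ∘ g)
  id⊗₁∘⊗₁ = trans ⊗₁∘⊗₁ (cong (_⊗₁ _) identityˡ)

  swap∘⊗₁ : {f : Hom X X′} {g : Hom Y Y′} → swap ∘ (f ⊗₁ g) ≡ (g ⊗₁ f) ∘ swap
  swap∘⊗₁ = trans ⟨⟩∘ (trans (cong₂ ⟨_,_⟩ π₂-β π₁-β) (sym ⊗₁∘⟨⟩))

  ∘swap∘swap : {h : Hom (X ⊗ Y) Z} → (h ∘ swap) ∘ swap ≡ h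
  ∘swap∘swap = trans assoc (trans (cong (_ ∘_) swap∘swap) identityʳ)
    where
    swap∘swap : swap ∘ swap ≡ id {X ⊗ Y}
    swap∘swap = trans ⟨⟩∘ (trans (cong₂ ⟨_,_⟩ π₂-β π₁-β) ⟨π₁,π₂⟩≡id)

  uncurry∘⊗₁id : {c : Hom X (Y ⇨ Z)} {h : Hom W X} → uncurry c ∘ (h ⊗₁ id) ≡ uncurry (c ∘ h)
  uncurry∘⊗₁id = trans assoc (cong (eval ∘_) ⊗₁id∘⊗₁id)

  curry-injective : {f g : Hom (X ⊗ Y) Z} → curry f ≡ curry g → f ≡ g
  curry-injective eq = trans (sym eval-β) (trans (cong uncurry eq) eval-β)

  curry∘ : {f : Hom (X ⊗ Y) Z} {h : Hom W X} → curry f ∘ h ≡ curry (f ∘ (h ⊗₁ id))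
  curry∘ = curry-unique (trans (sym uncurry∘⊗₁id) (cong (_∘ _) eval-β))

  eval∘curry⊗₁ : {f : Hom (X ⊗ Y) Z} {g : Hom W Y} → eval ∘ (curry f ⊗₁ g) ≡ f ∘ (id ⊗₁ g)
  eval∘curry⊗₁ = trans (cong (eval ∘_) ⊗₁≡⊗₁id∘id⊗₁) (trans (sym assoc) (cong (_∘ _) eval-β))

  eval∘⟨∘,⟩ : {a : Hom X (Y ⇨ Z)} {h : Hom W X} {x : Hom W Y} →
              eval ∘ ⟨ a ∘ h , x ⟩ ≡ uncurry a ∘ ⟨ h , x ⟩
  eval∘⟨∘,⟩ = sym (trans assoc (cong (eval ∘_) (trans ⊗₁∘⟨⟩ (cong (⟨ _ ,_⟩) identityˡ))))

  precomp : Hom Y′ Y → Hom (Y ⇨ Z) (Y′ ⇨ Z)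
  precomp g = curry (eval ∘ (id ⊗₁ g))

  precomp∘ : {g : Hom Y′ Y} {h : Hom W (Y ⇨ Z)} → precomp g ∘ h ≡ curry (eval ∘ (h ⊗₁ g))
  precomp∘ = trans curry∘ (cong curry (trans assoc (cong (eval ∘_) (sym ⊗₁≡id⊗₁∘⊗₁id))))

  precomp∘curry : {g : Hom Y′ Y} {f : Hom (W ⊗ Y) Z} → precomp g ∘ curry f ≡ curry (f ∘ (id ⊗₁ g))
  precomp∘curry = trans precomp∘ (cong curry eval∘curry⊗₁)

  precomp∘precomp : {a : Hom X Y′} {b : Hom Y′ Y} → precomp {Z = Z} a ∘ precomp b ≡ precomp (b ∘ a)
  precomp∘precomp = trans precomp∘curry (cong curry (trans assoc (cong (eval ∘_) id⊗₁∘⊗₁)))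

  eval∘⟨precomp∘,⟩ : {g : Hom Y′ Y} {h : Hom W (Y ⇨ Z)} {x : Hom W Y′} →
                     eval ∘ ⟨ precomp g ∘ h , x ⟩ ≡ eval ∘ ⟨ h , g ∘ x ⟩
  eval∘⟨precomp∘,⟩ {g = g} {h} {x} = begin
    eval ∘ ⟨ precomp g ∘ h , x ⟩
      ≡⟨ eval∘⟨∘,⟩ ⟩
    uncurry (precomp g) ∘ ⟨ h , x ⟩
      ≡⟨ cong (_∘ ⟨ h , x ⟩) eval-β ⟩
    (eval ∘ (id ⊗₁ g)) ∘ ⟨ h , x ⟩
      ≡⟨ trans assoc (cong (eval ∘_) ⊗₁∘⟨⟩) ⟩
    eval ∘ ⟨ id ∘ h , g ∘ x ⟩
      ≡⟨ cong (λ z → eval ∘ ⟨ z , g ∘ x ⟩) identityˡ ⟩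
    eval ∘ ⟨ h , g ∘ x ⟩ ∎

  ∐-ext : {Xs : ℕ → Obj} {h h′ : Hom (∐ Xs) Z} → (∀ n → h ∘ inj n ≡ h′ ∘ inj n) → h ≡ h′
  ∐-ext eq = trans (copair-unique eq) (sym (copair-unique (λ n → refl)))

  -- W ⊗ _ preserves the coproduct, being left adjoint to W ⇨ _: transpose and use ∐-ext.
  ⊗∐-ext : {Xs : ℕ → Obj} {h h′ : Hom (W ⊗ ∐ Xs) Z} →
           (∀ n → h ∘ (id ⊗₁ inj n) ≡ h′ ∘ (id ⊗₁ inj n)) → h ≡ h′
  ⊗∐-ext {h = h} {h′} eq =
    trans (sym ∘swap∘swap) (trans (cong (_∘ swap) transposes-agree) ∘swap∘swap)
    where
    curry-swap∘inj : ∀ k n → curry (k ∘ swap) ∘ inj n ≡ curry ((k ∘ (id ⊗₁ inj n)) ∘ swap)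
    curry-swap∘inj k n = trans curry∘ (cong curry (trans assoc (trans (cong (k ∘_) swap∘⊗₁) (sym assoc))))
    transposes-agree : h ∘ swap ≡ h′ ∘ swap
    transposes-agree = curry-injective (∐-ext λ n →
      trans (curry-swap∘inj h n)
        (trans (cong (λ z → curry (z ∘ swap)) (eq n)) (sym (curry-swap∘inj h′ n))))

module WordProperties {o ℓ} (C : CCC o ℓ) where
  open CCCKit C
  open CartesianClosedProperties C
  open ≡-Reasoning

  private variable
    A P Q R : Obj

  pow₁ : Hom P Q → (n : ℕ) → Hom (pow P n) (pow Q n)
  pow₁ f nzero = id
  pow₁ f (nsuc n) = f ⊗₁ pow₁ f n

  pow₁-id : (n : ℕ) → pow₁ (id {P}) n ≡ id
  pow₁-id nzero = refl
  pow₁-id (nsuc n) = trans (cong (id ⊗₁_) (pow₁-id n)) id⊗₁id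

  pow₁-∘ : {f : Hom P Q} {g : Hom Q R} (n : ℕ) → pow₁ g n ∘ pow₁ f n ≡ pow₁ (g ∘ f) n
  pow₁-∘ nzero = identityˡ
  pow₁-∘ (nsuc n) = trans ⊗₁∘⊗₁ (cong (_ ⊗₁_) (pow₁-∘ n))

  infix 10 _*₁ _⁺₁

  _*₁ : Hom P Q → Hom (P *) (Q *)
  _*₁ {Q = Q} f = copair (λ n → inj {X = pow Q} n ∘ pow₁ f n)

  _⁺₁ : Hom P Q → Hom (P ⁺) (Q ⁺)
  _⁺₁ {Q = Q} f = copair (λ n → inj {X = λ m → pow Q (nsuc m)} n ∘ pow₁ f (nsuc n))

  ⁺₁-id : id {P} ⁺₁ ≡ id
  ⁺₁-id = sym (copair-unique λ n →
    trans identityˡ (sym (trans (cong (inj n ∘_) (pow₁-id (nsuc n))) identityʳ)))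

  ⁺₁-∘ : {f : Hom P Q} {g : Hom Q R} → g ⁺₁ ∘ f ⁺₁ ≡ (g ∘ f) ⁺₁
  ⁺₁-∘ {f = f} {g} = ∐-ext λ n → begin
    (g ⁺₁ ∘ f ⁺₁) ∘ inj n
      ≡⟨ trans assoc (cong (g ⁺₁ ∘_) (copair-β n)) ⟩
    g ⁺₁ ∘ inj n ∘ pow₁ f (nsuc n)
      ≡⟨ trans (sym assoc) (cong (_∘ pow₁ f (nsuc n)) (copair-β n)) ⟩
    (inj n ∘ pow₁ g (nsuc n)) ∘ pow₁ f (nsuc n)
      ≡⟨ trans assoc (cong (inj n ∘_) (pow₁-∘ (nsuc n))) ⟩
    inj n ∘ pow₁ (g ∘ f) (nsuc n)
      ≡⟨ sym (copair-β n) ⟩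
    (g ∘ f) ⁺₁ ∘ inj n ∎

  ⁺₁-retraction : {f : Hom P Q} {r : Hom Q P} → r ∘ f ≡ id → r ⁺₁ ∘ f ⁺₁ ≡ id
  ⁺₁-retraction r∘f≡id = trans ⁺₁-∘ (trans (cong _⁺₁ r∘f≡id) ⁺₁-id)

  *₁∘nil : {f : Hom P Q} → f *₁ ∘ nil ≡ nil
  *₁∘nil = trans (copair-β nzero) identityʳ

  *₁∘incl : {f : Hom P Q} → f *₁ ∘ incl ≡ incl ∘ f ⁺₁
  *₁∘incl {f = f} = ∐-ext λ n → begin
    (f *₁ ∘ incl) ∘ inj n
      ≡⟨ trans assoc (cong (f *₁ ∘_) (copair-β n)) ⟩
    f *₁ ∘ inj (nsuc n)
      ≡⟨ copair-β (nsuc n) ⟩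
    inj (nsuc n) ∘ pow₁ f (nsuc n)
      ≡⟨ cong (_∘ pow₁ f (nsuc n)) (sym (copair-β n)) ⟩
    (incl ∘ inj n) ∘ pow₁ f (nsuc n)
      ≡⟨ trans assoc (cong (incl ∘_) (sym (copair-β n))) ⟩
    incl ∘ f ⁺₁ ∘ inj n
      ≡⟨ sym assoc ⟩
    (incl ∘ f ⁺₁) ∘ inj n ∎

  cons∘id⊗₁inj : (n : ℕ) → cons {P} ∘ (id ⊗₁ inj n) ≡ inj n
  cons∘id⊗₁inj {P} n = begin
    (uncurry c ∘ swap) ∘ (id ⊗₁ inj n)
      ≡⟨ trans assoc (cong (uncurry c ∘_) swap∘⊗₁) ⟩
    uncurry c ∘ (inj n ⊗₁ id) ∘ swap
      ≡⟨ trans (sym assoc) (cong (_∘ swap) uncurry∘⊗₁id) ⟩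
    uncurry (c ∘ inj n) ∘ swap
      ≡⟨ cong (λ z → uncurry z ∘ swap) (copair-β n) ⟩
    uncurry (curry (inj n ∘ swap)) ∘ swap
      ≡⟨ cong (_∘ swap) eval-β ⟩
    (inj n ∘ swap) ∘ swap
      ≡⟨ ∘swap∘swap ⟩
    inj n ∎
    where
    c = copair (λ n → curry (inj {X = λ m → pow P (nsuc m)} n ∘ swap))

  ⁺₁∘cons : {f : Hom P Q} → f ⁺₁ ∘ cons ≡ cons ∘ (f ⊗₁ f *₁)
  ⁺₁∘cons {f = f} = ⊗∐-ext λ n → begin
    (f ⁺₁ ∘ cons) ∘ (id ⊗₁ inj n)
      ≡⟨ trans assoc (cong (f ⁺₁ ∘_) (cons∘id⊗₁inj n)) ⟩
    f ⁺₁ ∘ inj n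
      ≡⟨ copair-β n ⟩
    inj n ∘ (f ⊗₁ pow₁ f n)
      ≡⟨ cong (_∘ (f ⊗₁ pow₁ f n)) (sym (cons∘id⊗₁inj n)) ⟩
    (cons ∘ (id ⊗₁ inj n)) ∘ (f ⊗₁ pow₁ f n)
      ≡⟨ trans assoc (cong (cons ∘_) id⊗₁∘⊗₁) ⟩
    cons ∘ (f ⊗₁ (inj n ∘ pow₁ f n))
      ≡⟨ cong (λ z → cons ∘ (f ⊗₁ z)) (sym (copair-β n)) ⟩
    cons ∘ (f ⊗₁ (f *₁ ∘ inj n))
      ≡⟨ trans (cong (cons ∘_) (sym ⊗₁∘id⊗₁)) (sym assoc) ⟩
    (cons ∘ (f ⊗₁ f *₁)) ∘ (id ⊗₁ inj n) ∎

  head∘precomp*₁ : {f : Hom P Q} → head {A = A} ∘ precomp (f *₁) ≡ head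
  head∘precomp*₁ {f = f} = begin
    (eval ∘ ⟨ id , nil ∘ ! ⟩) ∘ precomp (f *₁)
      ≡⟨ trans assoc (cong (eval ∘_) ⟨⟩∘) ⟩
    eval ∘ ⟨ id ∘ precomp (f *₁) , (nil ∘ !) ∘ precomp (f *₁) ⟩
       ≡⟨ cong₂ (λ a b → eval ∘ ⟨ a , b ⟩) (trans identityˡ (sym identityʳ))
                                           (trans assoc (cong (nil ∘_) (!-unique _))) ⟩
    eval ∘ ⟨ precomp (f *₁) ∘ id , nil ∘ ! ⟩
      ≡⟨ eval∘⟨precomp∘,⟩ ⟩
    eval ∘ ⟨ id , f *₁ ∘ nil ∘ ! ⟩
      ≡⟨ cong (λ z → eval ∘ ⟨ id , z ⟩) (trans (sym assoc) (cong (_∘ !) *₁∘nil)) ⟩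
    eval ∘ ⟨ id , nil ∘ ! ⟩ ∎

  -- tail = precomp incl
  tail∘precomp*₁ : {f : Hom P Q} → tail {A = A} ∘ precomp (f *₁) ≡ precomp (f ⁺₁) ∘ tail
  tail∘precomp*₁ = trans precomp∘precomp (trans (cong precomp *₁∘incl) (sym precomp∘precomp))

  evP-dinatural : {f : Hom P Q} →
                  evP {A = A} ∘ (id ⊗₁ precomp (f ⁺₁)) ≡ precomp (f *₁) ∘ evP ∘ (f ⊗₁ id)
  evP-dinatural {f = f} = begin
    curry E ∘ (id ⊗₁ precomp (f ⁺₁))
      ≡⟨ trans curry∘ (cong curry E∘⊗₁⊗₁) ⟩
    curry (eval ∘ ⟨ precomp (f ⁺₁) ∘ π₂ ∘ π₁ , cons ∘ (id ⊗₁ id) ∘ w ⟩)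
      ≡⟨ cong curry eval∘⟨precomp∘,⟩ ⟩
    curry (eval ∘ ⟨ π₂ ∘ π₁ , f ⁺₁ ∘ cons ∘ (id ⊗₁ id) ∘ w ⟩)
      ≡⟨ cong₂ (λ a b → curry (eval ∘ ⟨ a , b ⟩)) (sym identityˡ) cons-step ⟩
    curry (eval ∘ ⟨ id ∘ π₂ ∘ π₁ , cons ∘ (f ⊗₁ f *₁) ∘ w ⟩)
      ≡⟨ cong curry (sym E∘⊗₁⊗₁) ⟩
    curry (E ∘ ((f ⊗₁ id) ⊗₁ f *₁))
      ≡⟨ cong (λ z → curry (E ∘ z)) ⊗₁≡⊗₁id∘id⊗₁ ⟩
    curry (E ∘ ((f ⊗₁ id) ⊗₁ id) ∘ (id ⊗₁ f *₁))
      ≡⟨ trans (cong curry (sym assoc)) (sym precomp∘curry) ⟩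
    precomp (f *₁) ∘ curry (E ∘ ((f ⊗₁ id) ⊗₁ id))
      ≡⟨ cong (precomp (f *₁) ∘_) (sym curry∘) ⟩
    precomp (f *₁) ∘ curry E ∘ (f ⊗₁ id) ∎
    where
    E : ∀ {P} → Hom ((P ⊗ (P ⁺ ⇨ A)) ⊗ P *) A
    E = eval ∘ ⟨ π₂ ∘ π₁ , cons ∘ ⟨ π₁ ∘ π₁ , π₂ ⟩ ⟩
    w : ∀ {X Y Z} → Hom ((X ⊗ Y) ⊗ Z) (X ⊗ Z)
    w = ⟨ π₁ ∘ π₁ , π₂ ⟩
    E∘⊗₁⊗₁ : ∀ {P X Y Z} {a : Hom X P} {b : Hom Y (P ⁺ ⇨ A)} {c : Hom Z (P *)} →
             E ∘ ((a ⊗₁ b) ⊗₁ c) ≡ eval ∘ ⟨ b ∘ π₂ ∘ π₁ , cons ∘ (a ⊗₁ c) ∘ w ⟩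
    E∘⊗₁⊗₁ = trans assoc (cong (eval ∘_) (trans ⟨⟩∘
               (cong₂ ⟨_,_⟩ π₂∘π₁∘⊗₁⊗₁ (trans assoc (cong (cons ∘_) w∘⊗₁⊗₁)))))
      where
      w∘⊗₁⊗₁ : ∀ {X Y Z X′ Y′ Z′} {a : Hom X X′} {b : Hom Y Y′} {c : Hom Z Z′} →
               w ∘ ((a ⊗₁ b) ⊗₁ c) ≡ (a ⊗₁ c) ∘ w
      w∘⊗₁⊗₁ = trans ⟨⟩∘ (trans (cong₂ ⟨_,_⟩ π₁∘π₁∘⊗₁⊗₁ π₂-β) (sym ⊗₁∘⟨⟩))
    cons-step : f ⁺₁ ∘ cons ∘ (id ⊗₁ id) ∘ w ≡ cons ∘ (f ⊗₁ f *₁) ∘ w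
    cons-step = begin
      f ⁺₁ ∘ cons ∘ (id ⊗₁ id) ∘ w
        ≡⟨ cong (λ z → f ⁺₁ ∘ cons ∘ z) (trans (cong (_∘ w) id⊗₁id) identityˡ) ⟩
      f ⁺₁ ∘ cons ∘ w
        ≡⟨ trans (sym assoc) (trans (cong (_∘ w) ⁺₁∘cons) assoc) ⟩
      cons ∘ (f ⊗₁ f *₁) ∘ w ∎

  precomp*₁∘curry-cons : {f : Hom P Q} {u : Hom (Q ⁺) A} →
                         precomp (f *₁) ∘ curry (u ∘ cons) ∘ f ≡ curry ((u ∘ f ⁺₁) ∘ cons)
  precomp*₁∘curry-cons {f = f} {u} = begin
    precomp (f *₁) ∘ curry (u ∘ cons) ∘ f
      ≡⟨ trans (cong (precomp (f *₁) ∘_) curry∘) precomp∘curry ⟩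
    curry (((u ∘ cons) ∘ (f ⊗₁ id)) ∘ (id ⊗₁ f *₁))
      ≡⟨ cong curry (trans assoc (cong ((u ∘ cons) ∘_) (sym ⊗₁≡⊗₁id∘id⊗₁))) ⟩
    curry ((u ∘ cons) ∘ (f ⊗₁ f *₁))
      ≡⟨ cong curry (trans assoc (trans (cong (u ∘_) (sym ⁺₁∘cons)) (sym assoc))) ⟩
    curry ((u ∘ f ⁺₁) ∘ cons) ∎

module StrongEndofunctorProperties {o ℓ} {C : CCC o ℓ} (G : StrongEndofunctor C) where
  open CCCKit C
  open StrongEndofunctor G

  F₁-square : ∀ {X Y Y′ Z} {g : Hom Y Z} {k : Hom X Y} {k′ : Hom Y′ Z} {g′ : Hom X Y′} →
              g ∘ k ≡ k′ ∘ g′ → F₁ g ∘ F₁ k ≡ F₁ k′ ∘ F₁ g′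
  F₁-square sq = trans (sym F-∘) (trans (cong F₁ sq) F-∘)

module CompositeProperties {o ℓ} {C : CCC o ℓ} (T : StrongMonad C) (F : StrongEndofunctor C) where
  open CCCKit C
  open CartesianClosedProperties C
  private
    module T = StrongMonad T
    module F = StrongEndofunctor F
    module TP = StrongEndofunctorProperties T.functor
    module FP = StrongEndofunctorProperties F

  private variable
    X Y X′ Y′ Z : Obj

  FT-id : FT₁ T F (id {X}) ≡ id
  FT-id = trans (cong F.F₁ T.F-id) F.F-id

  FT-∘ : {f : Hom X Y} {g : Hom Y Z} → FT₁ T F (g ∘ f) ≡ FT₁ T F g ∘ FT₁ T F f
  FT-∘ = trans (cong F.F₁ T.F-∘) F.F-∘

  FT-square : {g : Hom Y Z} {k : Hom X Y} {k′ : Hom Y′ Z} {g′ : Hom X Y′} →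
              g ∘ k ≡ k′ ∘ g′ → FT₁ T F g ∘ FT₁ T F k ≡ FT₁ T F k′ ∘ FT₁ T F g′
  FT-square sq = FP.F₁-square (TP.F₁-square sq)

  stFT-natural : {f : Hom X X′} {g : Hom Y Y′} →
                 stFT T F ∘ (f ⊗₁ FT₁ T F g) ≡ FT₁ T F (f ⊗₁ g) ∘ stFT T F
  stFT-natural = glue (FP.F₁-square T.st-natural) F.st-natural

  stFTʳ-natural : {g : Hom Y Y′} → stFTʳ T F {X} ∘ (id ⊗₁ g) ≡ FT₁ T F (id ⊗₁ g) ∘ stFTʳ T F
  stFTʳ-natural = glue (FT-square swap∘⊗₁) (glue stFT-natural′ swap∘⊗₁)
    where
    stFT-natural′ : {g : Hom Y Y′} → stFT T F {Y′} {X} ∘ (g ⊗₁ id) ≡ FT₁ T F (g ⊗₁ id) ∘ stFT T F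
    stFT-natural′ = trans (cong (λ h → stFT T F ∘ (_ ⊗₁ h)) (sym FT-id)) stFT-natural

module OrderedObjectProperties {o ℓ} {C : CCC o ℓ} (Ω′ : OrderedObject C) where
  open CCCKit C
  open OrderedObject Ω′

  private variable
    X Y : Obj

  ⊥Ω∘ : (k : Hom X Y) → ⊥Ω ∘ k ≡ ⊥Ω
  ⊥Ω∘ k = trans (⋁-precomp ⊥-elim k) (≤-antisym (⋁-least _ λ j → ⊥-elim j) (⋁-least _ λ j → ⊥-elim j))

  ⋁-≤-reindex : {J J′ : Set ℓ} {f : J → Hom X Ω} {g : J′ → Hom X Ω} (r : J → J′) →
                (∀ j → f j ≡ g (r j)) → ⋁ f ≤ ⋁ g
  ⋁-≤-reindex {g = g} r eq = ⋁-least _ λ j → subst (_≤ ⋁ g) (sym (eq j)) (⋁-upper g (r j))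

module ObservationCoarsening {o ℓ} {C : CCC o ℓ} (T : StrongMonad C) (F : StrongEndofunctor C)
    {Ω′ : OrderedObject C} (alg : MonotoneAlgebra T F Ω′) (A I : CCC.Obj C) where
  open CCCKit C
  open CartesianClosedProperties C
  open WordProperties C
  open CompositeProperties T F
  open OrderedObject Ω′
  open OrderedObjectProperties Ω′
  open MonotoneAlgebra alg
  open Value T F alg A I
  open ≡-Reasoning

  private variable
    X Y S P Q : Obj

  Φ-∘ : {e : Hom X (FT T F X)} {e′ : Hom Y (FT T F Y)} {k : Hom Y X} →
        e ∘ k ≡ FT₁ T F k ∘ e′ → (g : Hom X Ω) → Φ e g ∘ k ≡ Φ e′ (g ∘ k)
  Φ-∘ {e = e} {e′} {k} sq g = begin
    (τ ∘ FT₁ T F g ∘ e) ∘ k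
      ≡⟨ trans assoc (cong (τ ∘_) assoc) ⟩
    τ ∘ FT₁ T F g ∘ e ∘ k
      ≡⟨ cong (λ z → τ ∘ FT₁ T F g ∘ z) sq ⟩
    τ ∘ FT₁ T F g ∘ FT₁ T F k ∘ e′
      ≡⟨ cong (τ ∘_) (trans (sym assoc) (cong (_∘ e′) (sym FT-∘))) ⟩
    τ ∘ FT₁ T F (g ∘ k) ∘ e′ ∎

  iter-Φ-∘ : {e : Hom X (FT T F X)} {e′ : Hom Y (FT T F Y)} {k : Hom Y X} →
             e ∘ k ≡ FT₁ T F k ∘ e′ →
             (n : ℕ) (g : Hom X Ω) → iter n (Φ e) g ∘ k ≡ iter n (Φ e′) (g ∘ k)
  iter-Φ-∘ sq nzero g = refl
  iter-Φ-∘ sq (nsuc n) g = trans (Φ-∘ sq _) (cong (Φ _) (iter-Φ-∘ sq n g))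

  restrict : Hom P Q → Hom (S ⊗ (Q * ⇨ A)) (S ⊗ (P * ⇨ A))
  restrict f = id ⊗₁ precomp (f *₁)

  Sch-natural : (δ : Hom S (A ⇨ FT T F S)) (p : Hom S P) (f : Hom P Q) →
                Sch δ p ∘ restrict f ≡ FT₁ T F (restrict f) ∘ Sch δ (f ∘ p)
  Sch-natural δ p f =
    glue (FT-square continuation-square) (glue stFTʳ-natural (glue ⊗₁-interchange split-square))
    where
    split : ∀ {P} → Hom (S ⊗ (P * ⇨ A)) ((S ⊗ A) ⊗ (P ⁺ ⇨ A))
    split = ⟨ ⟨ π₁ , head ∘ π₂ ⟩ , tail ∘ π₂ ⟩
    split-square : split ∘ restrict f ≡ (id ⊗₁ precomp (f ⁺₁)) ∘ split
    split-square = trans ⟨⟩∘ (trans (cong₂ ⟨_,_⟩ head-part tail-part) (sym ⊗₁∘⟨⟩))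
      where
      head-part : ⟨ π₁ , head ∘ π₂ ⟩ ∘ restrict f ≡ id ∘ ⟨ π₁ , head ∘ π₂ ⟩
      head-part = trans ⟨⟩∘ (trans (cong₂ ⟨_,_⟩ (trans π₁-β identityˡ)
                                                (trans ∘π₂∘⊗₁ (cong (_∘ π₂) head∘precomp*₁)))
                                   (sym identityˡ))
      tail-part : (tail ∘ π₂) ∘ restrict f ≡ precomp (f ⁺₁) ∘ tail ∘ π₂
      tail-part = trans ∘π₂∘⊗₁ (trans (cong (_∘ π₂) tail∘precomp*₁) assoc)
    continuation-square : ⟨ π₁ , evP ∘ (p ⊗₁ id) ⟩ ∘ (id ⊗₁ precomp (f ⁺₁))
                          ≡ restrict f ∘ ⟨ π₁ , evP ∘ ((f ∘ p) ⊗₁ id) ⟩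
    continuation-square = trans ⟨⟩∘ (trans (cong₂ ⟨_,_⟩ π₁-β evP-part) (sym ⊗₁∘⟨⟩))
      where
      evP-part : (evP ∘ (p ⊗₁ id)) ∘ (id ⊗₁ precomp (f ⁺₁)) ≡ precomp (f *₁) ∘ evP ∘ ((f ∘ p) ⊗₁ id)
      evP-part = begin
        (evP ∘ (p ⊗₁ id)) ∘ (id ⊗₁ precomp (f ⁺₁))
          ≡⟨ trans assoc (cong (evP ∘_) ⊗₁-interchange) ⟩
        evP ∘ (id ⊗₁ precomp (f ⁺₁)) ∘ (p ⊗₁ id)
          ≡⟨ trans (sym assoc) (cong (_∘ (p ⊗₁ id)) evP-dinatural) ⟩
        (precomp (f *₁) ∘ evP ∘ (f ⊗₁ id)) ∘ (p ⊗₁ id)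
          ≡⟨ trans assoc (cong (precomp (f *₁) ∘_) (trans assoc (cong (evP ∘_) ⊗₁id∘⊗₁id))) ⟩
        precomp (f *₁) ∘ evP ∘ ((f ∘ p) ⊗₁ id) ∎

  restrict-initial : (f : Hom P Q) (p : Hom S P) (u : Hom (Q ⁺) A) →
                     restrict f ∘ ⟨ id , curry (u ∘ cons) ∘ f ∘ p ⟩
                     ≡ ⟨ id , curry ((u ∘ f ⁺₁) ∘ cons) ∘ p ⟩
  restrict-initial f p u = trans ⊗₁∘⟨⟩ (cong₂ ⟨_,_⟩ identityˡ
    (trans (cong (precomp (f *₁) ∘_) (sym assoc))
           (trans (sym assoc) (cong (_∘ p) precomp*₁∘curry-cons))))

  V-term : Hom I S → Hom S (A ⇨ FT T F S) → Hom S P → Hom (P ⁺) A → ℕ → Hom I Ω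
  V-term i δ p u n = iter n (Φ (Sch δ p)) ⊥Ω ∘ ⟨ id , curry (u ∘ cons) ∘ p ⟩ ∘ i

  V-term-coarsening : (i : Hom I S) (δ : Hom S (A ⇨ FT T F S)) (p : Hom S P) (f : Hom P Q)
                      (u : Hom (Q ⁺) A) (n : ℕ) → V-term i δ (f ∘ p) u n ≡ V-term i δ p (u ∘ f ⁺₁) n
  V-term-coarsening {S = S} {P = P} {Q = Q} i δ p f u n = begin
    iter n (Φ (Sch δ (f ∘ p))) ⊥Ω ∘ x₀ ∘ i
      ≡⟨ cong (_∘ x₀ ∘ i) (sym pulled-back) ⟩
    (iter n (Φ (Sch δ p)) ⊥Ω ∘ restrict f) ∘ x₀ ∘ i
      ≡⟨ trans assoc (cong (iter n (Φ (Sch δ p)) ⊥Ω ∘_)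
                           (trans (sym assoc) (cong (_∘ i) (restrict-initial f p u)))) ⟩
    iter n (Φ (Sch δ p)) ⊥Ω ∘ x₁ ∘ i ∎
    where
    x₀ : Hom S (S ⊗ (Q * ⇨ A))
    x₀ = ⟨ id , curry (u ∘ cons) ∘ f ∘ p ⟩
    x₁ : Hom S (S ⊗ (P * ⇨ A))
    x₁ = ⟨ id , curry ((u ∘ f ⁺₁) ∘ cons) ∘ p ⟩
    pulled-back : iter n (Φ (Sch δ p)) ⊥Ω ∘ restrict f ≡ iter n (Φ (Sch δ (f ∘ p))) ⊥Ω
    pulled-back = trans (iter-Φ-∘ (Sch-natural δ p f) n ⊥Ω) (cong (iter n _) (⊥Ω∘ (restrict f)))

  V-coarsening-≤ : (i : Hom I S) (δ : Hom S (A ⇨ FT T F S)) (p : Hom S P) (f : Hom P Q) →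
                   V i δ (f ∘ p) ≤ V i δ p
  V-coarsening-≤ i δ p f =
    ⋁-≤-reindex (λ { (u , n) → u ∘ f ⁺₁ , n }) λ { (u , n) → V-term-coarsening i δ p f u n }

  V-coarsening-≥ : (i : Hom I S) (δ : Hom S (A ⇨ FT T F S)) (p : Hom S P) {f : Hom P Q} →
                   SplitMono f → V i δ p ≤ V i δ (f ∘ p)
  V-coarsening-≥ {P = P} i δ p {f} (r , r∘f≡id) =
    ⋁-≤-reindex (λ { (u , n) → u ∘ r ⁺₁ , n }) λ { (u , n) →
      trans (cong (λ v → V-term i δ p v n) (sym (u∘r⁺∘f⁺≡u u)))
            (sym (V-term-coarsening i δ p f (u ∘ r ⁺₁) n)) }
    where
    u∘r⁺∘f⁺≡u : (u : Hom (P ⁺) A) → (u ∘ r ⁺₁) ∘ f ⁺₁ ≡ u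
    u∘r⁺∘f⁺≡u u = trans assoc (trans (cong (u ∘_) (⁺₁-retraction r∘f≡id)) identityʳ)

proposition7p1 : ∀ {o ℓ} {C : CCC o ℓ} (T : StrongMonad C) (F : StrongEndofunctor C)
                   (Ω′ : OrderedObject C) (alg : MonotoneAlgebra T F Ω′) →
                   let open CCCKit C in let open OrderedObject Ω′ in let open Value T F alg in
                   (A I : Obj) {S O : Obj} (i : Hom I S) (δ : Hom S (A ⇨ FT T F S)) (obs : Hom S O) →
                   (V A I i δ obs ≤ V A I i δ id)
                   × (SplitMono obs → V A I i δ obs ≡ V A I i δ id)
proposition7p1 {C = C} T F Ω′ alg A I i δ obs =
  V-obs≤V-id , λ obs-split → ≤-antisym V-obs≤V-id (V-id≤V-obs obs-split)
  where
  open CCCKit C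
  open OrderedObject Ω′
  open Value T F alg A I
  open ObservationCoarsening T F alg A I
  V-obs∘id≡V-obs : V i δ (obs ∘ id) ≡ V i δ obs
  V-obs∘id≡V-obs = cong (V i δ) identityʳ
  V-obs≤V-id : V i δ obs ≤ V i δ id
  V-obs≤V-id = subst (_≤ V i δ id) V-obs∘id≡V-obs (V-coarsening-≤ i δ id obs)
  V-id≤V-obs : SplitMono obs → V i δ id ≤ V i δ obs
  V-id≤V-obs obs-split = subst (V i δ id ≤_) V-obs∘id≡V-obs (V-coarsening-≥ i δ id obs-split)
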